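{- Let $A$ be a regular system of divisors, $S$ a nonempty subset of $\mathbb N$ and $n\in\mathbb N$. Then \[ \Phi_{A,S,n}(x)=(-1)^{\varrho_S(n)}\,x^{\varphi_{A,S}(n)}\,\Phi_{A,S,n}(1/x). \] Consequently $\Phi_{A,S,n}(x)$ is antipalindromic if $n\in S$ and palindromic if $n\notin S$.
   Context: A regular system of divisors is a family $A=(A(n))_{n\in\mathbb N}$, where each $A(n)$ is a set of positive divisors of $n$, such that: (i) $A(1)=\{1\}$ and $A(mn)=\{de: d\in A(m), e\in A(n)\}$ whenever $\gcd(m,n)=1$; (ii) for every prime power $p^a$ ($a\ge1$) there is a divisor $t=t_A(p^a)$ of $a$ such that $A(p^{it})=\{1,p^t,\dots,p^{it}\}$ for every $0\le i\le a/t$. For $j\in\mathbb Z$, $(j,n)_A=\max\{d\in\mathbb N: d\mid j,\ d\in A(n)\}$. Let $\zeta_n=e^{2\pi i/n}$. For nonempty $S\subseteq\mathbb N$, $\varrho_S$ is its characteristic function, $\Phi_{A,S,n}(x)=\prod_{1\le j\le n,\ (j,n)_A\in S}(x-\zeta_n^j)$, and $\varphi_{A,S}(n)=\#\{1\le j\le n: (j,n)_A\in S\}$ is its degree. A polynomial $P$ of degree $m$ is palindromic if $P(x)=x^mP(1/x)$ and antipalindromic if $P(x)=-x^mP(1/x)$. -}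

module Defs where

open import Level using (Level)
open import Algebra.Bundles using (CommutativeRing)
open import Data.Bool using (Bool; true; false; if_then_else_; T)
open import Data.Bool.Properties using (T?)
open import Data.Nat using (ℕ; zero; suc; _∸_; _^_; _≤_; _<_; _⊔_; _≤?_)
import Data.Nat as N
open import Data.Nat.Divisibility using (_∣_; _∣?_)
open import Data.Nat.Coprimality using (Coprime)
open import Data.Nat.Primality using (Prime)
open import Data.List using (List; []; _∷_; foldr; filter; map; length; upTo)
open import Data.Product using (_×_; ∃-syntax)
open import Relation.Nullary.Decidable using (_×-dec_; ⌊_⌋)
open import Relation.Binary.PropositionalEquality using (_≡_)

-- Regular systems of divisors.
-- A system A is given by its (decidable) membership relation:
-- inA n d ≡ true  means  d ∈ A(n).  Only n ≥ 1 is relevant.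

IsRegular : (ℕ → ℕ → Bool) → Set
IsRegular inA =
  (∀ n d → 1 ≤ n → inA n d ≡ true → (1 ≤ d × d ∣ n))
  × (∀ d → (inA 1 d ≡ true → d ≡ 1) × (d ≡ 1 → inA 1 d ≡ true))
  × (∀ m n → 1 ≤ m → 1 ≤ n → Coprime m n → ∀ k →
       (inA (m N.* n) k ≡ true → ∃[ d ] ∃[ e ] (inA m d ≡ true × inA n e ≡ true × k ≡ d N.* e))
     × (∀ d e → inA m d ≡ true → inA n e ≡ true → inA (m N.* n) (d N.* e) ≡ true))
  × (∀ p a → Prime p → 1 ≤ a → ∃[ t ] (t ∣ a × (∀ i → i N.* t ≤ a → ∀ d →
       (inA (p ^ (i N.* t)) d ≡ true → ∃[ k ] (k ≤ i × d ≡ p ^ (k N.* t)))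
     × (∀ k → k ≤ i → inA (p ^ (i N.* t)) (p ^ (k N.* t)) ≡ true))))

-- (j , n)_A = max { d : d ∣ j , d ∈ A(n) }  (elements of A(n) are ≤ n, so we search 0..n)
gcdA : (ℕ → ℕ → Bool) → ℕ → ℕ → ℕ
gcdA inA n j = foldr _⊔_ 0 (filter (λ d → (d ∣? j) ×-dec T? (inA n d)) (upTo (suc n)))

indexSet : (ℕ → ℕ → Bool) → (ℕ → Bool) → ℕ → List ℕ
indexSet inA S n = filter (λ j → T? (S (gcdA inA n j))) (map suc (upTo n))

phiAS : (ℕ → ℕ → Bool) → (ℕ → Bool) → ℕ → ℕ
phiAS inA S n = length (indexSet inA S n)

module Poly {c ℓ : Level} (R : CommutativeRing c ℓ) where
  open CommutativeRing R

  Pol : Set c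
  Pol = ℕ → Carrier

  _≈ₚ_ : Pol → Pol → Set ℓ
  P ≈ₚ Q = ∀ i → P i ≈ Q i

  pow : Carrier → ℕ → Carrier
  pow x zero = 1#
  pow x (suc k) = x * pow x k

  sumTo : (ℕ → Carrier) → ℕ → Carrier
  sumTo f zero = f 0
  sumTo f (suc k) = sumTo f k + f (suc k)

  mulP : Pol → Pol → Pol
  mulP P Q k = sumTo (λ i → P i * Q (k ∸ i)) k

  oneP : Pol
  oneP zero = 1#
  oneP (suc _) = 0#

  linP : Carrier → Pol
  linP a zero = - a
  linP a (suc zero) = 1#
  linP a (suc (suc _)) = 0#

  scaleP : Carrier → Pol → Pol
  scaleP b P i = b * P i

  prodP : List Pol → Pol
  prodP = foldr mulP oneP

  -- x^m P(1/x) for a polynomial P of degree ≤ m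
  recip : ℕ → Pol → Pol
  recip m P i = if ⌊ i ≤? m ⌋ then P (m ∸ i) else 0#

  Palindromic : ℕ → Pol → Set ℓ
  Palindromic m P = P ≈ₚ recip m P

  Antipalindromic : ℕ → Pol → Set ℓ
  Antipalindromic m P = P ≈ₚ scaleP (- 1#) (recip m P)

  PhiAS : (ℕ → ℕ → Bool) → (ℕ → Bool) → ℕ → Carrier → Pol
  PhiAS inA S n ζ = prodP (map (λ j → linP (pow ζ j)) (indexSet inA S n))

  signS : (ℕ → Bool) → ℕ → Carrier
  signS S n = if S n then - 1# else 1#

-- Let I be the set of indices 1 ≤ j ≤ n with (j, n)_A ∈ S, so Φ = ∏_{j ∈ I} (x - ζ^j) and
-- x^|I| Φ(1/x) = ∏_{j ∈ I} (1 - ζ^j x) = ∏_{j ∈ I} (- ζ^j) · ∏_{j ∈ I} (x - ζ^(n - j)).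
-- Every element of A(n) divides n, so (n - j, n)_A = (j, n)_A and j ↦ n - j permutes the
-- indices j < n in I; and n ∈ A(n), so (n, n)_A = n and n ∈ I exactly when n ∈ S. Hence the
-- last product is Φ again, and the constant is c · (-1)^ϱ_S(n), where c = ∏ (- ζ^j) over
-- the indices j < n in I. Finally c = 1: writing P = ∏ (1 - ζ^j) over the same indices,
-- 1 - ζ^j = (- ζ^j)(1 - ζ^(n - j)) gives P = c P, and P ≠ 0 because ζ is primitive and the
-- ring has no zero divisors.

module Submission where

open import Defs
open import Algebra.Bundles using (CommutativeRing)
open import Data.Bool using (Bool; true; false; if_then_else_)
open import Data.Nat using (ℕ; suc; _≤_; _<_)
open import Data.Product using (_×_; _,_; ∃-syntax)
open import Data.Sum using (_⊎_)
open import Relation.Nullary using (¬_)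
open import Relation.Binary.PropositionalEquality using (_≡_; subst)

module RegularSystems where

  open import Data.Bool using (T)
  open import Data.Bool.Properties using (T?; T-≡)
  open import Data.Nat
  open import Data.Nat.Properties
  open import Data.Nat.Divisibility
  open import Data.Nat.Coprimality using (Coprime; 1-coprimeTo; coprime-divisor)
  open import Data.Nat.Induction using (<-rec)
  open import Data.Nat.Primality using (Prime; prime⇒irreducible; prime⇒nonTrivial)
  open import Data.Nat.Primality.Factorisation using (factorise)
  open import Data.Nat.ListAction using (product)
  open import Data.List using (_∷_; foldr; upTo)
  open import Data.List.Membership.Propositional using (_∈_)
  open import Data.List.Membership.Propositional.Properties using (∈-filter⁺; ∈-upTo⁺)
  open import Data.List.Properties using (filter-≐)
  open import Data.List.Relation.Unary.All using (All; []; _∷_)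
  open import Data.List.Relation.Unary.All.Properties using (filter⁺; applyUpTo⁺₁)
  open import Data.List.Relation.Unary.Any using (here; there)
  open import Data.Product using (proj₁; proj₂)
  open import Data.Sum using (inj₁; inj₂)
  open import Function using (Equivalence; id)
  open import Relation.Nullary using (yes; no; contradiction)
  open import Relation.Nullary.Decidable using (_×-dec_)
  open import Relation.Binary.PropositionalEquality

  ∃-prime-divisor : ∀ n → 2 ≤ n → ∃[ p ] (Prime p × p ∣ n)
  ∃-prime-divisor 1 (s≤s ())
  ∃-prime-divisor n@(suc (suc _)) _ with factorise n
  ... | record { factors = p ∷ ps ; isFactorisation = n≡p*ps ; factorsPrime = p-prime ∷ _ } =
    p , p-prime , divides (product ps) (trans n≡p*ps (*-comm p (product ps)))

  prime⇒coprime-nondivisor : ∀ {p m} → Prime p → ¬ p ∣ m → Coprime p m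
  prime⇒coprime-nondivisor p-prime p∤m (d∣p , d∣m) with prime⇒irreducible p-prime d∣p
  ... | inj₁ d≡1 = d≡1
  ... | inj₂ refl = contradiction d∣m p∤m

  coprime-*ˡ : ∀ {x y m} → Coprime x m → Coprime y m → Coprime (x * y) m
  coprime-*ˡ {x} {y} x⊥m y⊥m {d} (d∣xy , d∣m) =
    x⊥m (coprime-divisor d⊥y (subst (d ∣_) (*-comm x y) d∣xy) , d∣m)
    where
    d⊥y : Coprime d y
    d⊥y (e∣d , e∣y) = y⊥m (e∣y , ∣-trans e∣d d∣m)

  coprime-^ : ∀ {p m} → Prime p → ¬ p ∣ m → ∀ a → Coprime (p ^ a) m
  coprime-^ {m = m} _ _ zero = 1-coprimeTo m
  coprime-^ p-prime p∤m (suc a) =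
    coprime-*ˡ (prime⇒coprime-nondivisor p-prime p∤m) (coprime-^ p-prime p∤m a)

  ∣-∸ : ∀ {d m n} → n ≤ m → d ∣ m → d ∣ n → d ∣ m ∸ n
  ∣-∸ {d} n≤m d∣m d∣n = ∣m+n∣m⇒∣n (subst (d ∣_) (sym (m+[n∸m]≡n n≤m)) d∣m) d∣n

  foldr-⊔-lub : ∀ {n xs} → All (_≤ n) xs → foldr _⊔_ 0 xs ≤ n
  foldr-⊔-lub []             = z≤n
  foldr-⊔-lub (x≤n ∷ xs≤n) = ⊔-lub x≤n (foldr-⊔-lub xs≤n)

  ∈⇒≤-foldr-⊔ : ∀ {x xs} → x ∈ xs → x ≤ foldr _⊔_ 0 xs
  ∈⇒≤-foldr-⊔ (here refl) = m≤m⊔n _ _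
  ∈⇒≤-foldr-⊔ (there x∈xs) = m≤n⇒m≤o⊔n _ (∈⇒≤-foldr-⊔ x∈xs)

  gcdA-self : ∀ {inA n} → inA n n ≡ true → gcdA inA n n ≡ n
  gcdA-self {inA} {n} n∈A = ≤-antisym
    (foldr-⊔-lub (filter⁺ P? (applyUpTo⁺₁ id (suc n) ≤-pred)))
    (∈⇒≤-foldr-⊔ (∈-filter⁺ P? (∈-upTo⁺ ≤-refl) (∣-refl , Equivalence.from T-≡ n∈A)))
    where
    P? = λ d → (d ∣? n) ×-dec T? (inA n d)

  factor-out-prime : ∀ {p} → Prime p → ∀ n → 1 ≤ n → ∃[ a ] ∃[ m ] (n ≡ p ^ a * m × ¬ p ∣ m)
  factor-out-prime {p} p-prime = <-rec _ go
    where
    go : ∀ n → (∀ {q} → q < n → 1 ≤ q → ∃[ a ] ∃[ m ] (q ≡ p ^ a * m × ¬ p ∣ m)) →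
         1 ≤ n → ∃[ a ] ∃[ m ] (n ≡ p ^ a * m × ¬ p ∣ m)
    go n rec 1≤n with p ∣? n
    ... | no p∤n = 0 , n , sym (+-identityʳ n) , p∤n
    ... | yes (divides q n≡q*p) =
      let instance _ = >-nonZero (subst (0 <_) n≡q*p 1≤n)
                   _ = m*n≢0⇒m≢0 q
                   _ = prime⇒nonTrivial p-prime
          a , m , q≡pᵃ*m , p∤m = rec (subst (q <_) (sym n≡q*p) (m<m*n q p (nonTrivial⇒n>1 p)))
                                     (>-nonZero⁻¹ q)
      in suc a , m , (begin
           n               ≡⟨ n≡q*p ⟩
           q * p           ≡⟨ *-comm q p ⟩
           p * q           ≡⟨ cong (p *_) q≡pᵃ*m ⟩
           p * (p ^ a * m) ≡⟨ *-assoc p (p ^ a) m ⟨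
           p ^ suc a * m   ∎) , p∤m
      where open ≡-Reasoning

  module _ {inA : ℕ → ℕ → Bool} (regular : IsRegular inA) where

    private
      one∈A1         = proj₁ (proj₂ regular)
      multiplicative = proj₁ (proj₂ (proj₂ regular))
      primePowers    = proj₂ (proj₂ (proj₂ regular))

    ∈A⇒∣ : ∀ {n d} → 1 ≤ n → inA n d ≡ true → d ∣ n
    ∈A⇒∣ 1≤n d∈A = proj₂ (proj₁ regular _ _ 1≤n d∈A)

    primePower∈A : ∀ {p a} → Prime p → 1 ≤ a → inA (p ^ a) (p ^ a) ≡ true
    primePower∈A {p} p-prime 1≤a with primePowers p _ p-prime 1≤a
    ... | t , divides i refl , chain = proj₂ (chain i ≤-refl 0) i ≤-refl

    coprime-*∈A : ∀ {m n} → 1 ≤ m → 1 ≤ n → Coprime m n →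
                  inA m m ≡ true → inA n n ≡ true → inA (m * n) (m * n) ≡ true
    coprime-*∈A 1≤m 1≤n m⊥n m∈A n∈A = proj₂ (multiplicative _ _ 1≤m 1≤n m⊥n 0) _ _ m∈A n∈A

    self∈A : ∀ n → 1 ≤ n → inA n n ≡ true
    self∈A = <-rec _ go
      where
      go : ∀ n → (∀ {m} → m < n → 1 ≤ m → inA m m ≡ true) → 1 ≤ n → inA n n ≡ true
      go 1 _ _ = proj₂ (one∈A1 1) refl
      go n@(suc (suc _)) rec _ with ∃-prime-divisor n (s≤s (s≤s z≤n))
      ... | p , p-prime , p∣n with factor-out-prime p-prime n (s≤s z≤n)
      ... | zero , m , n≡1*m , p∤m = contradiction (subst (p ∣_) (trans n≡1*m (*-identityˡ m)) p∣n) p∤m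
      ... | suc a , m , n≡pᵃ*m , p∤m = subst (λ x → inA x x ≡ true) (sym n≡pᵃ*m)
          (coprime-*∈A (m^n>0 p (suc a)) 1≤m (coprime-^ p-prime p∤m (suc a))
                       (primePower∈A {a = suc a} p-prime (s≤s z≤n)) (rec m<n 1≤m))
        where
        instance
          _ = prime⇒nonTrivial p-prime
          _ = nonTrivial⇒nonZero p
        1≤m : 1 ≤ m
        1≤m = n≢0⇒n>0 λ { refl → p∤m (p ∣0) }
        1<pᵃ : 1 < p ^ suc a
        1<pᵃ = <-≤-trans (nonTrivial⇒n>1 p) (m≤m*n p (p ^ a) {{m^n≢0 p a}})
        m<n : m < n
        m<n = subst (m <_) (trans (*-comm m (p ^ suc a)) (sym n≡pᵃ*m))
                (m<m*n m (p ^ suc a) {{>-nonZero 1≤m}} 1<pᵃ)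

    gcdA-∸ : ∀ {n j} → 1 ≤ n → j ≤ n → gcdA inA n (n ∸ j) ≡ gcdA inA n j
    gcdA-∸ {n} {j} 1≤n j≤n =
      cong (foldr _⊔_ 0) (filter-≐ (A-divisor? (n ∸ j)) (A-divisor? j) (to , from) (upTo (suc n)))
      where
      A-divisor? = λ k d → (d ∣? k) ×-dec T? (inA n d)
      to : ∀ {d} → d ∣ n ∸ j × T (inA n d) → d ∣ j × T (inA n d)
      to (d∣n∸j , d∈A) = subst (_ ∣_) (m∸[m∸n]≡n j≤n)
                           (∣-∸ (m∸n≤m n j) (∈A⇒∣ 1≤n (Equivalence.to T-≡ d∈A)) d∣n∸j) , d∈A
      from : ∀ {d} → d ∣ j × T (inA n d) → d ∣ n ∸ j × T (inA n d)
      from (d∣j , d∈A) = ∣-∸ j≤n (∈A⇒∣ 1≤n (Equivalence.to T-≡ d∈A)) d∣j , d∈A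

module ListLemmas where

  open import Data.Nat using (zero; _∸_)
  open import Data.List using ([]; _∷_; _++_; map; filter; reverse; upTo; applyUpTo; applyDownFrom; [_])
  open import Data.List.Properties using (filter-++; unfold-reverse; ++-identityʳ; map-∘; map-upTo; reverse-applyUpTo)
  open import Data.List.Relation.Unary.All using (All; []; _∷_)
  open import Data.List.Relation.Binary.Pointwise using (Pointwise; []; _∷_)
  open import Relation.Nullary using (does)
  open import Relation.Unary using (Pred; Decidable)
  open import Relation.Binary.PropositionalEquality using (refl; sym; cong; module ≡-Reasoning)

  module _ {a p} {A : Set a} {P : Pred A p} (P? : Decidable P) where

    filter-reverse : ∀ xs → filter P? (reverse xs) ≡ reverse (filter P? xs)
    filter-reverse [] = refl
    filter-reverse (x ∷ xs) = begin
      filter P? (reverse (x ∷ xs))               ≡⟨ cong (filter P?) (unfold-reverse x xs) ⟩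
      filter P? (reverse xs ++ [ x ])            ≡⟨ filter-++ P? (reverse xs) [ x ] ⟩
      filter P? (reverse xs) ++ filter P? [ x ]  ≡⟨ cong (_++ filter P? [ x ]) (filter-reverse xs) ⟩
      reverse (filter P? xs) ++ filter P? [ x ]  ≡⟨ snoc-filter ⟩
      reverse (filter P? (x ∷ xs))               ∎
      where
      open ≡-Reasoning
      snoc-filter : reverse (filter P? xs) ++ filter P? [ x ] ≡ reverse (filter P? (x ∷ xs))
      snoc-filter with does (P? x)
      ... | true  = sym (unfold-reverse x (filter P? xs))
      ... | false = ++-identityʳ _

    map-filter-comm : (f : A → A) → ∀ {xs} → All (λ x → does (P? (f x)) ≡ does (P? x)) xs →
                      map f (filter P? xs) ≡ filter P? (map f xs)
    map-filter-comm f [] = refl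
    map-filter-comm f {x ∷ _} (eq ∷ eqs) with does (P? (f x)) | does (P? x) | eq
    ... | true  | true  | _ = cong (f x ∷_) (map-filter-comm f eqs)
    ... | false | false | _ = map-filter-comm f eqs

  applyUpTo-∸ : ∀ k → applyUpTo (k ∸_) k ≡ applyDownFrom suc k
  applyUpTo-∸ zero    = refl
  applyUpTo-∸ (suc k) = cong (suc k ∷_) (applyUpTo-∸ k)

  reflect-interval : ∀ k → map (suc k ∸_) (map suc (upTo k)) ≡ reverse (map suc (upTo k))
  reflect-interval k = begin
    map (suc k ∸_) (map suc (upTo k)) ≡⟨ map-∘ (upTo k) ⟨
    map (k ∸_) (upTo k)               ≡⟨ map-upTo (k ∸_) k ⟩
    applyUpTo (k ∸_) k                ≡⟨ applyUpTo-∸ k ⟩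
    applyDownFrom suc k               ≡⟨ reverse-applyUpTo suc k ⟨
    reverse (applyUpTo suc k)         ≡⟨ cong reverse (map-upTo suc k) ⟨
    reverse (map suc (upTo k))        ∎
    where open ≡-Reasoning

  All⇒Pointwise-map : ∀ {a b c r} {A : Set a} {B : Set b} {C : Set c} {R : B → C → Set r}
                      {f : A → B} {g : A → C} {xs} →
                      All (λ x → R (f x) (g x)) xs → Pointwise R (map f xs) (map g xs)
  All⇒Pointwise-map []         = []
  All⇒Pointwise-map (r ∷ rs) = r ∷ All⇒Pointwise-map rs

module IndexSet {inA : ℕ → ℕ → Bool} (regular : IsRegular inA) (S : ℕ → Bool) (k : ℕ) where

  open RegularSystems
  open ListLemmas
  open import Data.Bool using (T)
  open import Data.Bool.Properties using (T?)
  open import Data.Nat using (_∸_; z≤n; s≤s)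
  open import Data.Nat.Properties using (<⇒≤)
  open import Data.List using (List; []; _++_; map; filter; reverse; upTo; [_])
  open import Data.List.Properties using (filter-++; map-++; upTo-∷ʳ)
  open import Data.List.Relation.Unary.All using (All)
  import Data.List.Relation.Unary.All as All
  import Data.List.Relation.Unary.All.Properties as All
  open import Function using (id; _∘_)
  open import Relation.Nullary using (does)
  open import Relation.Unary using (Decidable)
  open import Relation.Binary.PropositionalEquality using (refl; cong; module ≡-Reasoning)

  n : ℕ
  n = suc k

  inS? : Decidable (λ j → T (S (gcdA inA n j)))
  inS? j = T? (S (gcdA inA n j))

  interior : List ℕ
  interior = filter inS? (map suc (upTo k))

  endpoint : List ℕ
  endpoint = filter inS? [ n ]

  indexSet-split : indexSet inA S n ≡ interior ++ endpoint
  indexSet-split = begin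
    filter inS? (map suc (upTo n))               ≡⟨ cong (filter inS? ∘ map suc) (upTo-∷ʳ k) ⟨
    filter inS? (map suc (upTo k ++ [ k ]))      ≡⟨ cong (filter inS?) (map-++ suc (upTo k) [ k ]) ⟩
    filter inS? (map suc (upTo k) ++ [ n ])      ≡⟨ filter-++ inS? (map suc (upTo k)) [ n ] ⟩
    interior ++ endpoint                         ∎
    where open ≡-Reasoning

  indexSet-bounded : All (_≤ n) (indexSet inA S n)
  indexSet-bounded = All.filter⁺ inS? (All.map⁺ (All.applyUpTo⁺₁ id n id))

  interval-bounds : All (λ j → 1 ≤ j × j < n) (map suc (upTo k))
  interval-bounds = All.map⁺ (All.applyUpTo⁺₁ id k (λ i<k → s≤s z≤n , s≤s i<k))

  interior-bounds : All (λ j → 1 ≤ j × j < n) interior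
  interior-bounds = All.filter⁺ inS? interval-bounds

  interior-reflect : map (n ∸_) interior ≡ reverse interior
  interior-reflect = begin
    map (n ∸_) (filter inS? (map suc (upTo k)))     ≡⟨ map-filter-comm inS? (n ∸_) interval-symmetric ⟩
    filter inS? (map (n ∸_) (map suc (upTo k)))     ≡⟨ cong (filter inS?) (reflect-interval k) ⟩
    filter inS? (reverse (map suc (upTo k)))        ≡⟨ filter-reverse inS? (map suc (upTo k)) ⟩
    reverse interior                                ∎
    where
    open ≡-Reasoning
    interval-symmetric : All (λ j → does (inS? (n ∸ j)) ≡ does (inS? j)) (map suc (upTo k))
    interval-symmetric = All.map (λ (_ , j<n) → cong (does ∘ T? ∘ S) (gcdA-∸ regular (s≤s z≤n) (<⇒≤ j<n)))
                                 interval-bounds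

  endpoint-≡ : endpoint ≡ (if S n then [ n ] else [])
  endpoint-≡ rewrite gcdA-self {inA} (self∈A regular n (s≤s z≤n)) with S n
  ... | true  = refl
  ... | false = refl

module RootProducts {c ℓ} (R : CommutativeRing c ℓ) where

  open import Data.Nat as ℕ using (zero; _∸_; s≤s; _≤?_)
  open import Data.Nat.Properties as ℕ using (<-cmp)
  open import Data.List using (List; []; _∷_; _++_; map; foldr; length)
  open import Data.List.Relation.Binary.Pointwise using (Pointwise; []; _∷_)
  open import Data.List.Relation.Unary.All using (All; []; _∷_)
  import Data.List.Relation.Unary.All as All
  import Data.List.Relation.Unary.All.Properties as All
  open import Data.Sum using (inj₁; inj₂)
  open import Relation.Binary.Bundles using (Setoid)
  import Relation.Binary.Reasoning.Setoid as SetoidReasoning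
  open import Relation.Binary.Definitions using (tri<; tri≈; tri>)
  open import Relation.Nullary using (yes; no; contradiction)
  import Relation.Binary.PropositionalEquality as ≡

  open CommutativeRing R hiding (zero)
  open Poly R
  open import Algebra.Properties.Ring ring using (-‿distribˡ-*; -‿distribʳ-*; x[y-z]≈xy-xz; [y-z]x≈yx-zx)
  open import Algebra.Properties.Group +-group using (⁻¹-involutive; x∙y⁻¹≈ε⇒x≈y; x≈y⇒x∙y⁻¹≈ε)
  open import Algebra.Properties.AbelianGroup +-abelianGroup using (⁻¹-anti-homo‿-)
  open import Algebra.Properties.CommutativeSemigroup +-commutativeSemigroup using () renaming (interchange to +-interchange)
  open import Algebra.Properties.CommutativeSemigroup *-commutativeSemigroup using (x∙yz≈y∙xz; interchange)
  open import Data.List.Relation.Binary.Permutation.Setoid setoid as ↭ using (_↭_)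
  open import Data.List.Relation.Binary.Permutation.Setoid.Properties setoid using (foldr-commMonoid; map⁺)

  ≈ₚ-setoid : Setoid c ℓ
  ≈ₚ-setoid = record
    { Carrier = Pol
    ; _≈_ = _≈ₚ_
    ; isEquivalence = record
      { refl = λ _ → refl
      ; sym = λ P≈Q i → sym (P≈Q i)
      ; trans = λ P≈Q Q≈U i → trans (P≈Q i) (Q≈U i)
      }
    }

  module ≈ₚ = Setoid ≈ₚ-setoid
  module ≈-Reasoning = SetoidReasoning setoid
  module ≈ₚ-Reasoning = SetoidReasoning ≈ₚ-setoid

  -[x*-y]≈x*y : ∀ x y → - (x * - y) ≈ x * y
  -[x*-y]≈x*y x y = trans (-‿cong (sym (-‿distribʳ-* x y))) (⁻¹-involutive (x * y))

  [-a]*[y-bx]≈x-ay : ∀ {a b} → a * b ≈ 1# → ∀ x y → (- a) * (y - b * x) ≈ x - a * y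
  [-a]*[y-bx]≈x-ay {a} {b} ab≈1 x y = begin
    (- a) * (y - b * x)           ≈⟨ x[y-z]≈xy-xz (- a) y (b * x) ⟩
    (- a) * y - (- a) * (b * x)   ≈⟨ +-cong (-‿distribˡ-* a y) (-‿cong (-‿distribˡ-* a (b * x))) ⟨
    - (a * y) - - (a * (b * x))   ≈⟨ +-congˡ (⁻¹-involutive (a * (b * x))) ⟩
    - (a * y) + a * (b * x)       ≈⟨ +-congˡ (trans (sym (*-assoc a b x)) (trans (*-congʳ ab≈1) (*-identityˡ x))) ⟩
    - (a * y) + x                 ≈⟨ +-comm _ x ⟩
    x - a * y                     ∎
    where open ≈-Reasoning

  linMul : Carrier → Pol → Pol
  linMul a Q zero    = - (a * Q zero)
  linMul a Q (suc k) = Q k - a * Q (suc k)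

  sumTo-two-terms : ∀ {f} → (∀ i → f (suc (suc i)) ≈ 0#) → ∀ k → sumTo f (suc k) ≈ f 0 + f 1
  sumTo-two-terms f≈0 zero    = refl
  sumTo-two-terms f≈0 (suc k) = trans (+-cong (sumTo-two-terms f≈0 k) (f≈0 k)) (+-identityʳ _)

  mulP-linP : ∀ a Q → mulP (linP a) Q ≈ₚ linMul a Q
  mulP-linP a Q zero    = sym (-‿distribˡ-* a (Q 0))
  mulP-linP a Q (suc k) = begin
    sumTo (λ i → linP a i * Q (suc k ∸ i)) (suc k) ≈⟨ sumTo-two-terms (λ i → zeroˡ _) k ⟩
    (- a) * Q (suc k) + 1# * Q k                   ≈⟨ +-cong (-‿distribˡ-* a _) (sym (*-identityˡ (Q k))) ⟨
    - (a * Q (suc k)) + Q k                        ≈⟨ +-comm _ (Q k) ⟩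
    Q k - a * Q (suc k)                            ∎
    where open ≈-Reasoning

  linMul-cong : ∀ {a b P Q} → a ≈ b → P ≈ₚ Q → linMul a P ≈ₚ linMul b Q
  linMul-cong a≈b P≈Q zero    = -‿cong (*-cong a≈b (P≈Q 0))
  linMul-cong a≈b P≈Q (suc k) = +-cong (P≈Q k) (-‿cong (*-cong a≈b (P≈Q (suc k))))

  [u-bv]-a[v-bw]-comm : ∀ a b u v w → (u - b * v) - a * (v - b * w) ≈ (u - a * v) - b * (v - a * w)
  [u-bv]-a[v-bw]-comm a b u v w = begin
    (u - b * v) - a * (v - b * w)          ≈⟨ +-congˡ (-‿cong (x[y-z]≈xy-xz a v (b * w))) ⟩
    (u - b * v) - (a * v - a * (b * w))     ≈⟨ +-congˡ (⁻¹-anti-homo‿- _ _) ⟩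
    (u - b * v) + (a * (b * w) - a * v)     ≈⟨ +-congˡ (+-comm _ _) ⟩
    (u - b * v) + (- (a * v) + a * (b * w)) ≈⟨ +-interchange u _ _ _ ⟩
    (u - a * v) + (- (b * v) + a * (b * w)) ≈⟨ +-congˡ (+-cong refl (x∙yz≈y∙xz a b w)) ⟩
    (u - a * v) + (- (b * v) + b * (a * w)) ≈⟨ +-congˡ (+-comm _ _) ⟩
    (u - a * v) + (b * (a * w) - b * v)     ≈⟨ +-congˡ (⁻¹-anti-homo‿- _ _) ⟨
    (u - a * v) - (b * v - b * (a * w))     ≈⟨ +-congˡ (-‿cong (x[y-z]≈xy-xz b v (a * w))) ⟨
    (u - a * v) - b * (v - a * w)          ∎
    where open ≈-Reasoning

  linMul-comm : ∀ a b Q → linMul a (linMul b Q) ≈ₚ linMul b (linMul a Q)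
  linMul-comm a b Q zero = begin
    - (a * - (b * Q 0)) ≈⟨ -[x*-y]≈x*y a (b * Q 0) ⟩
    a * (b * Q 0)       ≈⟨ x∙yz≈y∙xz a b (Q 0) ⟩
    b * (a * Q 0)       ≈⟨ -[x*-y]≈x*y b (a * Q 0) ⟨
    - (b * - (a * Q 0)) ∎
    where open ≈-Reasoning
  linMul-comm a b Q (suc zero) = begin
    - (b * Q 0) - a * (Q 0 - b * Q 1)         ≈⟨ +-congʳ (+-identityˡ _) ⟨
    (0# - b * Q 0) - a * (Q 0 - b * Q 1)      ≈⟨ [u-bv]-a[v-bw]-comm a b 0# (Q 0) (Q 1) ⟩
    (0# - a * Q 0) - b * (Q 0 - a * Q 1)      ≈⟨ +-congʳ (+-identityˡ _) ⟩
    - (a * Q 0) - b * (Q 0 - a * Q 1)         ∎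
    where open ≈-Reasoning
  linMul-comm a b Q (suc (suc k)) = [u-bv]-a[v-bw]-comm a b (Q k) (Q (suc k)) (Q (suc (suc k)))

  scaleP-cong : ∀ {d e P Q} → d ≈ e → P ≈ₚ Q → scaleP d P ≈ₚ scaleP e Q
  scaleP-cong d≈e P≈Q i = *-cong d≈e (P≈Q i)

  scaleP-scaleP : ∀ d e P → scaleP d (scaleP e P) ≈ₚ scaleP (d * e) P
  scaleP-scaleP d e P i = sym (*-assoc d e (P i))

  linMul-scaleP : ∀ a d Q → linMul a (scaleP d Q) ≈ₚ scaleP d (linMul a Q)
  linMul-scaleP a d Q zero    = trans (-‿cong (x∙yz≈y∙xz a d (Q 0))) (-‿distribʳ-* d _)
  linMul-scaleP a d Q (suc k) =
    trans (+-congˡ (-‿cong (x∙yz≈y∙xz a d (Q (suc k))))) (sym (x[y-z]≈xy-xz d (Q k) _))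

  scaleP-flip : ∀ {d P Q} → d * d ≈ 1# → P ≈ₚ scaleP d Q → Q ≈ₚ scaleP d P
  scaleP-flip {d} {P} {Q} dd≈1 P≈dQ i = begin
    Q i             ≈⟨ *-identityˡ (Q i) ⟨
    1# * Q i        ≈⟨ *-congʳ dd≈1 ⟨
    (d * d) * Q i   ≈⟨ *-assoc d d (Q i) ⟩
    d * (d * Q i)   ≈⟨ *-congˡ (P≈dQ i) ⟨
    d * P i         ∎
    where open ≈-Reasoning

  DegreeAtMost : ℕ → Pol → Set ℓ
  DegreeAtMost m P = ∀ i → m < i → P i ≈ 0#

  linMul-degree : ∀ {m a Q} → DegreeAtMost m Q → DegreeAtMost (suc m) (linMul a Q)
  linMul-degree {a = a} Q≤m (suc i) (s≤s m<i) = trans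
    (+-cong (Q≤m i m<i) (-‿cong (trans (*-congˡ (Q≤m (suc i) (ℕ.m<n⇒m<1+n m<i))) (zeroʳ a))))
    (-‿inverseʳ 0#)

  recip-cong : ∀ m {P Q} → P ≈ₚ Q → recip m P ≈ₚ recip m Q
  recip-cong m P≈Q i with i ≤? m
  ... | yes _ = P≈Q (m ∸ i)
  ... | no _  = refl

  recip-≤ : ∀ {m i} P → i ℕ.≤ m → recip m P i ≡ P (m ∸ i)
  recip-≤ {m} {i} P i≤m with i ≤? m
  ... | yes _   = ≡.refl
  ... | no  i≰m = contradiction i≤m i≰m

  recip-> : ∀ {m i} P → m < i → recip m P i ≡ 0#
  recip-> {m} {i} P m<i with i ≤? m
  ... | yes i≤m = contradiction i≤m (ℕ.<⇒≱ m<i)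
  ... | no  _   = ≡.refl

  recip-linMul : ∀ {m a b Q} → DegreeAtMost m Q → a * b ≈ 1# →
                 recip (suc m) (linMul a Q) ≈ₚ scaleP (- a) (linMul b (recip m Q))
  recip-linMul {m} {a} {b} {Q} Q≤m ab≈1 zero = begin
    Q m - a * Q (suc m)                   ≈⟨ +-congˡ (-‿cong (*-congˡ (Q≤m (suc m) ℕ.≤-refl))) ⟩
    Q m - a * 0#                          ≈⟨ [-a]*[y-bx]≈x-ay ab≈1 (Q m) 0# ⟨
    (- a) * (0# - b * Q m)                ≈⟨ *-congˡ (+-identityˡ _) ⟩
    (- a) * - (b * Q m)                   ∎
    where open ≈-Reasoning
  recip-linMul {m} {a} {b} {Q} Q≤m ab≈1 (suc i) with <-cmp i m
  ... | tri< i<m _ _ = let t = m ∸ suc i; m∸i≡1+t = ℕ.+-∸-assoc 1 i<m in begin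
    recip (suc m) (linMul a Q) (suc i)     ≡⟨ recip-≤ (linMul a Q) (s≤s (ℕ.<⇒≤ i<m)) ⟩
    linMul a Q (m ∸ i)                     ≡⟨ ≡.cong (linMul a Q) m∸i≡1+t ⟩
    Q t - a * Q (suc t)                    ≈⟨ [-a]*[y-bx]≈x-ay ab≈1 (Q t) (Q (suc t)) ⟨
    (- a) * (Q (suc t) - b * Q t)          ≡⟨ ≡.cong₂ (λ x y → - a * (x - b * y))
                                                 (≡.trans (recip-≤ Q (ℕ.<⇒≤ i<m)) (≡.cong Q m∸i≡1+t))
                                                 (recip-≤ Q i<m) ⟨
    (- a) * (recip m Q i - b * recip m Q (suc i)) ∎
    where open ≈-Reasoning
  ... | tri≈ _ ≡.refl _ = begin
    recip (suc m) (linMul a Q) (suc m)     ≡⟨ recip-≤ {suc m} (linMul a Q) ℕ.≤-refl ⟩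
    linMul a Q (m ∸ m)                     ≡⟨ ≡.cong (linMul a Q) (ℕ.n∸n≡0 m) ⟩
    - (a * Q 0)                            ≈⟨ +-identityˡ _ ⟨
    0# - a * Q 0                           ≈⟨ [-a]*[y-bx]≈x-ay ab≈1 0# (Q 0) ⟨
    (- a) * (Q 0 - b * 0#)                 ≡⟨ ≡.cong₂ (λ x y → - a * (x - b * y))
                                                 (≡.trans (recip-≤ Q ℕ.≤-refl) (≡.cong Q (ℕ.n∸n≡0 m)))
                                                 (recip-> Q ℕ.≤-refl) ⟨
    (- a) * (recip m Q m - b * recip m Q (suc m)) ∎
    where open ≈-Reasoning
  ... | tri> _ _ m<i = begin
    recip (suc m) (linMul a Q) (suc i)     ≡⟨ recip-> (linMul a Q) (s≤s m<i) ⟩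
    0#                                     ≈⟨ zeroʳ (- a) ⟨
    (- a) * 0#                             ≈⟨ *-congˡ (trans (+-congˡ (-‿cong (zeroʳ b))) (-‿inverseʳ 0#)) ⟨
    (- a) * (0# - b * 0#)                  ≡⟨ ≡.cong₂ (λ x y → - a * (x - b * y))
                                                 (recip-> Q m<i) (recip-> Q (ℕ.m<n⇒m<1+n m<i)) ⟨
    (- a) * (recip m Q i - b * recip m Q (suc i)) ∎
    where open ≈-Reasoning

  fromRoots : List Carrier → Pol
  fromRoots = foldr linMul oneP

  prodP-linP : ∀ as → prodP (map linP as) ≈ₚ fromRoots as
  prodP-linP []       = ≈ₚ.refl
  prodP-linP (a ∷ as) = ≈ₚ.trans (mulP-linP a _) (linMul-cong refl (prodP-linP as))

  fromRoots-≋ : ∀ {as bs} → Pointwise _≈_ as bs → fromRoots as ≈ₚ fromRoots bs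
  fromRoots-≋ []                = ≈ₚ.refl
  fromRoots-≋ (a≈b ∷ as≋bs) = linMul-cong a≈b (fromRoots-≋ as≋bs)

  fromRoots-↭ : ∀ {as bs} → as ↭ bs → fromRoots as ≈ₚ fromRoots bs
  fromRoots-↭ (↭.refl as≋bs)       = fromRoots-≋ as≋bs
  fromRoots-↭ (↭.prep a≈b as↭bs)   = linMul-cong a≈b (fromRoots-↭ as↭bs)
  fromRoots-↭ (↭.swap {x = a} {y = b} a≈a′ b≈b′ as↭bs) =
    ≈ₚ.trans (linMul-comm a b _) (linMul-cong b≈b′ (linMul-cong a≈a′ (fromRoots-↭ as↭bs)))
  fromRoots-↭ (↭.trans as↭bs bs↭cs) = ≈ₚ.trans (fromRoots-↭ as↭bs) (fromRoots-↭ bs↭cs)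

  fromRoots-degree : ∀ as → DegreeAtMost (length as) (fromRoots as)
  fromRoots-degree []       (suc i) _ = refl
  fromRoots-degree (a ∷ as) = linMul-degree (fromRoots-degree as)

  prod : List Carrier → Carrier
  prod = foldr _*_ 1#

  prod-++ : ∀ xs ys → prod (xs ++ ys) ≈ prod xs * prod ys
  prod-++ []       ys = sym (*-identityˡ _)
  prod-++ (x ∷ xs) ys = trans (*-congˡ (prod-++ xs ys)) (sym (*-assoc x _ _))

  recip-fromRoots : ∀ {as bs} → Pointwise (λ a b → a * b ≈ 1#) as bs →
                    recip (length as) (fromRoots as) ≈ₚ scaleP (prod (map -_ as)) (fromRoots bs)
  recip-fromRoots [] zero    = sym (*-identityˡ 1#)
  recip-fromRoots [] (suc i) = sym (zeroʳ 1#)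
  recip-fromRoots {a ∷ as} {b ∷ bs} (ab≈1 ∷ inverses) = begin
    recip (suc (length as)) (linMul a (fromRoots as))        ≈⟨ recip-linMul (fromRoots-degree as) ab≈1 ⟩
    scaleP (- a) (linMul b (recip (length as) (fromRoots as))) ≈⟨ scaleP-cong refl (linMul-cong refl (recip-fromRoots inverses)) ⟩
    scaleP (- a) (linMul b (scaleP d (fromRoots bs)))       ≈⟨ scaleP-cong refl (linMul-scaleP b d _) ⟩
    scaleP (- a)  (scaleP d (linMul b (fromRoots bs)))       ≈⟨ scaleP-scaleP (- a) d _ ⟩
    scaleP (- a * d) (linMul b (fromRoots bs))              ∎
    where
    open ≈ₚ-Reasoning
    d = prod (map -_ as)

  1-a≈[-a]*[1-b] : ∀ {a b} → a * b ≈ 1# → 1# - a ≈ (- a) * (1# - b)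
  1-a≈[-a]*[1-b] {a} {b} ab≈1 = begin
    1# - a                 ≈⟨ +-congˡ (-‿cong (*-identityʳ a)) ⟨
    1# - a * 1#            ≈⟨ [-a]*[y-bx]≈x-ay ab≈1 1# 1# ⟨
    (- a) * (1# - b * 1#)  ≈⟨ *-congˡ (+-congˡ (-‿cong (*-identityʳ b))) ⟩
    (- a) * (1# - b)       ∎
    where open ≈-Reasoning

  prod-1- : ∀ {as bs} → Pointwise (λ a b → a * b ≈ 1#) as bs →
            prod (map (λ a → 1# - a) as) ≈ prod (map -_ as) * prod (map (λ a → 1# - a) bs)
  prod-1- []                 = sym (*-identityˡ 1#)
  prod-1- (ab≈1 ∷ inverses) = trans (*-cong (1-a≈[-a]*[1-b] ab≈1) (prod-1- inverses)) (interchange _ _ _ _)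

  module _ (noZeroDivisors : ∀ x y → x * y ≈ 0# → x ≈ 0# ⊎ y ≈ 0#) where

    prod-≉0 : ¬ 1# ≈ 0# → ∀ {as} → All (λ a → ¬ a ≈ 0#) as → ¬ prod as ≈ 0#
    prod-≉0 1≉0 []             = 1≉0
    prod-≉0 1≉0 (a≉0 ∷ as≉0) prod≈0 with noZeroDivisors _ _ prod≈0
    ... | inj₁ a≈0    = a≉0 a≈0
    ... | inj₂ rest≈0 = prod-≉0 1≉0 as≉0 rest≈0

    x≈c*x⇒c≈1 : ∀ {c x} → ¬ x ≈ 0# → x ≈ c * x → c ≈ 1#
    x≈c*x⇒c≈1 {c} {x} x≉0 x≈cx with noZeroDivisors (1# - c) x [1-c]x≈0
      where
      [1-c]x≈0 : (1# - c) * x ≈ 0#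
      [1-c]x≈0 = trans ([y-z]x≈yx-zx x 1# c) (trans (+-congʳ (*-identityˡ x)) (x≈y⇒x∙y⁻¹≈ε x≈cx))
    ... | inj₁ 1-c≈0 = sym (x∙y⁻¹≈ε⇒x≈y 1# c 1-c≈0)
    ... | inj₂ x≈0   = contradiction x≈0 x≉0

    prod-map-neg≈1 : ¬ 1# ≈ 0# → ∀ {as bs} → Pointwise (λ a b → a * b ≈ 1#) as bs → bs ↭ as →
                     All (λ a → ¬ a ≈ 1#) as → prod (map -_ as) ≈ 1#
    prod-map-neg≈1 1≉0 {as} {bs} inverses bs↭as as≉1 = x≈c*x⇒c≈1 P≉0 (begin
      P                                               ≈⟨ prod-1- inverses ⟩
      prod (map -_ as) * prod (map (λ b → 1# - b) bs) ≈⟨ *-congˡ permuted ⟩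
      prod (map -_ as) * P                            ∎)
      where
      open ≈-Reasoning
      P = prod (map (λ a → 1# - a) as)
      P≉0 : ¬ P ≈ 0#
      P≉0 = prod-≉0 1≉0 (All.map⁺ (All.map (λ a≉1 1-a≈0 → a≉1 (sym (x∙y⁻¹≈ε⇒x≈y 1# _ 1-a≈0))) as≉1))
      permuted : prod (map (λ b → 1# - b) bs) ≈ P
      permuted = foldr-commMonoid *-isCommutativeMonoid (map⁺ setoid (λ b≈a → +-congˡ (-‿cong b≈a)) bs↭as)

module PhiReciprocity {c ℓ} (R : CommutativeRing c ℓ) where

  open ListLemmas
  open import Data.Nat as ℕ using (zero; _∸_)
  open import Data.Nat.Properties as ℕ using (m+[n∸m]≡n; n∸n≡0)
  open import Data.List using (List; _++_; map; reverse; length)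
  open import Data.List.Properties using (map-∘; map-++; reverse-map; length-map)
  open import Data.List.Relation.Binary.Pointwise using (Pointwise; []; _∷_)
  import Data.List.Relation.Unary.All as All
  import Data.List.Relation.Unary.All.Properties as All
  import Relation.Binary.PropositionalEquality as ≡

  open CommutativeRing R hiding (zero)
  open Poly R
  open RootProducts R
  open import Algebra.Properties.Ring ring using (-1*x≈-x)
  open import Algebra.Properties.Group +-group using (⁻¹-involutive)
  open import Data.List.Relation.Binary.Permutation.Setoid setoid as ↭ using (_↭_; ↭-reflexive; ↭-trans)
  open import Data.List.Relation.Binary.Permutation.Setoid.Properties setoid using (↭-reverse; ++⁺)

  pow-+ : ∀ x i j → pow x (i ℕ.+ j) ≈ pow x i * pow x j
  pow-+ x zero    j = sym (*-identityˡ _)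
  pow-+ x (suc i) j = trans (*-congˡ (pow-+ x i j)) (sym (*-assoc x _ _))

  signS-squared : ∀ S n → signS S n * signS S n ≈ 1#
  signS-squared S n with S n
  ... | true  = trans (-1*x≈-x (- 1#)) (⁻¹-involutive 1#)
  ... | false = *-identityˡ 1#

  module _ {inA : ℕ → ℕ → Bool} (regular : IsRegular inA) (S : ℕ → Bool) (k : ℕ)
           (ζ : Carrier) (ζⁿ≈1 : pow ζ (suc k) ≈ 1#) where

    open IndexSet regular S k

    coroot : ℕ → Carrier
    coroot j = pow ζ (n ∸ j)

    root*coroot≈1 : ∀ {j} → j ≤ n → pow ζ j * coroot j ≈ 1#
    root*coroot≈1 {j} j≤n = begin
      pow ζ j * pow ζ (n ∸ j) ≈⟨ pow-+ ζ j (n ∸ j) ⟨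
      pow ζ (j ℕ.+ (n ∸ j))   ≡⟨ ≡.cong (pow ζ) (m+[n∸m]≡n j≤n) ⟩
      pow ζ n                 ≈⟨ ζⁿ≈1 ⟩
      1#                      ∎
      where open ≈-Reasoning

    interiorRoots : List Carrier
    interiorRoots = map (pow ζ) interior

    endpointRoots : List Carrier
    endpointRoots = map (pow ζ) endpoint

    roots-split : map (pow ζ) (indexSet inA S n) ≡ interiorRoots ++ endpointRoots
    roots-split = ≡.trans (≡.cong (map (pow ζ)) indexSet-split) (map-++ (pow ζ) interior endpoint)

    interior-coroots : map coroot interior ≡ reverse interiorRoots
    interior-coroots = begin
      map coroot interior                ≡⟨ map-∘ interior ⟩
      map (pow ζ) (map (n ∸_) interior)  ≡⟨ ≡.cong (map (pow ζ)) interior-reflect ⟩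
      map (pow ζ) (reverse interior)     ≡⟨ reverse-map (pow ζ) interior ⟩
      reverse interiorRoots              ∎
      where open ≡.≡-Reasoning

    interior-coroots-↭ : map coroot interior ↭ interiorRoots
    interior-coroots-↭ = ↭-trans (↭-reflexive interior-coroots) (↭-reverse interiorRoots)

    endpoint-coroots : Pointwise _≈_ (map coroot endpoint) endpointRoots
    endpoint-coroots rewrite endpoint-≡ with S n
    ... | true  = trans (reflexive (≡.cong (pow ζ) (n∸n≡0 n))) (sym ζⁿ≈1) ∷ []
    ... | false = []

    coroots-↭ : map coroot (indexSet inA S n) ↭ map (pow ζ) (indexSet inA S n)
    coroots-↭ rewrite indexSet-split | map-++ coroot interior endpoint | map-++ (pow ζ) interior endpoint =
      ++⁺ interior-coroots-↭ (↭.refl endpoint-coroots)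

    prod-neg-endpoint : prod (map -_ endpointRoots) ≈ signS S n
    prod-neg-endpoint rewrite endpoint-≡ with S n
    ... | true  = trans (*-identityʳ _) (-‿cong ζⁿ≈1)
    ... | false = refl

    module _ (1≉0 : ¬ 1# ≈ 0#) (noZeroDivisors : ∀ x y → x * y ≈ 0# → x ≈ 0# ⊎ y ≈ 0#)
             (ζ-primitive : ∀ j → 1 ≤ j → j < n → ¬ pow ζ j ≈ 1#) where

      prod-neg-interior : prod (map -_ interiorRoots) ≈ 1#
      prod-neg-interior = prod-map-neg≈1 noZeroDivisors 1≉0
        (All⇒Pointwise-map (All.map (λ (_ , j<n) → root*coroot≈1 (ℕ.<⇒≤ j<n)) interior-bounds))
        interior-coroots-↭
        (All.map⁺ (All.map (λ (1≤j , j<n) → ζ-primitive _ 1≤j j<n) interior-bounds))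

      prod-neg-roots : prod (map -_ (map (pow ζ) (indexSet inA S n))) ≈ signS S n
      prod-neg-roots = begin
        prod (map -_ (map (pow ζ) (indexSet inA S n)))            ≡⟨ ≡.cong (λ as → prod (map -_ as)) roots-split ⟩
        prod (map -_ (interiorRoots ++ endpointRoots))            ≡⟨ ≡.cong prod (map-++ -_ interiorRoots endpointRoots) ⟩
        prod (map -_ interiorRoots ++ map -_ endpointRoots)       ≈⟨ prod-++ (map -_ interiorRoots) _ ⟩
        prod (map -_ interiorRoots) * prod (map -_ endpointRoots) ≈⟨ *-cong prod-neg-interior prod-neg-endpoint ⟩
        1# * signS S n                                            ≈⟨ *-identityˡ _ ⟩
        signS S n                                                 ∎
        where open ≈-Reasoning

      recip-PhiAS : recip (phiAS inA S n) (PhiAS inA S n ζ) ≈ₚ scaleP (signS S n) (PhiAS inA S n ζ)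
      recip-PhiAS = begin
        recip (length I) Φ                                      ≈⟨ recip-cong _ Φ≈fromRoots ⟩
        recip (length I) (fromRoots roots)                      ≡⟨ ≡.cong (λ m → recip m (fromRoots roots)) length-roots ⟨
        recip (length roots) (fromRoots roots)                  ≈⟨ recip-fromRoots inverse-pairs ⟩
        scaleP (prod (map -_ roots)) (fromRoots (map coroot I)) ≈⟨ scaleP-cong prod-neg-roots (fromRoots-↭ coroots-↭) ⟩
        scaleP (signS S n) (fromRoots roots)                    ≈⟨ scaleP-cong refl Φ≈fromRoots ⟨
        scaleP (signS S n) Φ                                    ∎
        where
        open ≈ₚ-Reasoning
        I = indexSet inA S n
        roots = map (pow ζ) I
        Φ = PhiAS inA S n ζ
        length-roots : length roots ≡ length I
        length-roots = length-map (pow ζ) I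
        inverse-pairs : Pointwise (λ a b → a * b ≈ 1#) roots (map coroot I)
        inverse-pairs = All⇒Pointwise-map (All.map root*coroot≈1 indexSet-bounded)
        Φ≈fromRoots : Φ ≈ₚ fromRoots roots
        Φ≈fromRoots = ≈ₚ.trans (≈ₚ.reflexive (≡.cong prodP (map-∘ I))) (prodP-linP roots)

corollary1 : ∀ {c ℓ} (R : CommutativeRing c ℓ) →
    let open CommutativeRing R
        open Poly R
    in ¬ (1# ≈ 0#) → (∀ x y → x * y ≈ 0# → (x ≈ 0# ⊎ y ≈ 0#)) →
       (inA : ℕ → ℕ → Bool) → IsRegular inA →
       (S : ℕ → Bool) → ∃[ s ] (1 ≤ s × S s ≡ true) →
       (n : ℕ) → 1 ≤ n →
       (ζ : Carrier) → pow ζ n ≈ 1# → (∀ k → 1 ≤ k → k < n → ¬ (pow ζ k ≈ 1#)) →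
       (PhiAS inA S n ζ ≈ₚ scaleP (signS S n) (recip (phiAS inA S n) (PhiAS inA S n ζ)))
       × (S n ≡ true → Antipalindromic (phiAS inA S n) (PhiAS inA S n ζ))
       × (S n ≡ false → Palindromic (phiAS inA S n) (PhiAS inA S n ζ))
corollary1 R 1≉0 noZeroDivisors inA regular S _ (suc k) _ ζ ζⁿ≈1 ζ-primitive =
  reciprocal , antipalindromic , palindromic
  where
  open CommutativeRing R
  open Poly R
  open RootProducts R
  open PhiReciprocity R

  n = suc k
  Φ = PhiAS inA S n ζ
  m = phiAS inA S n

  reciprocal : Φ ≈ₚ scaleP (signS S n) (recip m Φ)
  reciprocal = scaleP-flip (signS-squared S n) (recip-PhiAS regular S k ζ ζⁿ≈1 1≉0 noZeroDivisors ζ-primitive)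

  reciprocal-at : ∀ {b} → S n ≡ b → Φ ≈ₚ scaleP (if b then - 1# else 1#) (recip m Φ)
  reciprocal-at Sn≡b = subst (λ b → Φ ≈ₚ scaleP (if b then - 1# else 1#) (recip m Φ)) Sn≡b reciprocal

  antipalindromic : S n ≡ true → Antipalindromic m Φ
  antipalindromic = reciprocal-at

  palindromic : S n ≡ false → Palindromic m Φ
  palindromic Sn≡false i = trans (reciprocal-at Sn≡false i) (*-identityˡ _)
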